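{- Let $k\ge1$ and $0\le\ell<2k$ be integers and $G=(V,E)$ a multigraph on $n$ vertices ($n\ge1$ if $\ell\le k$, $n\ge2$ if $\ell>k$). Consider any moment of the basic $(k,\ell)$-pebble game on $G$, with current directed graph $D$. Let $e=uv$ be an edge not yet inserted in $D$ that is independent with respect to $D$ (i.e. the undirected multigraph of the edges of $D$ together with $e$ is $(k,\ell)$-sparse), and suppose strictly fewer than $\ell+1$ free pebbles are present on $u$ and $v$. Then there is a directed path in $D$ from one of $u,v$ to a vertex $w\notin\{u,v\}$ carrying a free pebble; consequently, by a pebble collection move, a pebble can be brought to one of $u$ or $v$ without changing the pebble count of the other.
   Context: Basic $(k,\ell)$-pebble game: maintain a directed multigraph $D$ on $V$, initially with no edges, and a number $peb(w)$ of free pebbles on each vertex $w$, initially $k$. Process the edges of $G$ one at a time in an arbitrary order. For the current edge $e=uv$ (possibly $u=v$), the number of pebbles present on $u$ and $v$ is $P=peb(u)+peb(v)$ if $u\ne v$ and $P=peb(u)$ if $u=v$. While $P<\ell+1$, try a pebble collection move: find a directed path in $D$ from some $x\in\{u,v\}$ to a vertex $w\notin\{u,v\}$ with $peb(w)\ge1$; reverse every edge on the path, decrease $peb(w)$ by 1, increase $peb(x)$ by 1. If $P<\ell+1$ and no such path exists, $e$ is rejected. Once $P\ge\ell+1$, $e$ is accepted: choose an endpoint, say $u$, with $peb(u)\ge1$, insert $u\to v$ into $D$ (a loop if $u=v$) and decrease $peb(u)$ by 1. A multigraph is $(k,\ell)$-sparse if every subset of $n'$ vertices spans (induces) at most $\max\{0,kn'-\ell\}$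 edges, loops included. -}

module Defs where

open import Data.Nat using (ℕ; zero; suc; _+_; _*_; _∸_; _≤_; _<_; pred)
open import Data.Bool using (Bool; true; false; _∧_; if_then_else_)
open import Data.Fin using (Fin; _≟_)
open import Data.Fin.Subset using (Subset; ∣_∣)
open import Data.Vec using (lookup)
open import Data.List using (List; []; _∷_; _++_; length; filterᵇ; map)
open import Data.List.Membership.Propositional using (_∈_)
open import Data.List.Relation.Unary.Unique.Propositional using (Unique)
open import Data.List.Relation.Binary.Permutation.Propositional using (_↭_)
open import Data.Product using (_×_; _,_; Σ; ∃; ∃-syntax; proj₁; proj₂)
open import Data.Sum using (_⊎_)
open import Relation.Nullary using (¬_; yes; no)
open import Relation.Binary.PropositionalEquality using (_≡_)

-- Vertices are Fin n.  An (undirected) edge uv of a multigraph, and a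
-- directed edge u→v, are both represented as a pair (u , v); a loop is (u , u).
Edge : ℕ → Set
Edge n = Fin n × Fin n

swap : ∀ {n} → Edge n → Edge n
swap (a , b) = (b , a)

spanned : ∀ {n} → Subset n → List (Edge n) → ℕ
spanned S es = length (filterᵇ (λ e → lookup S (proj₁ e) ∧ lookup S (proj₂ e)) es)

-- (k,ℓ)-sparse: every vertex subset with n' vertices spans at most
-- max{0, k n' - ℓ} = k n' ∸ ℓ edges
Sparse : ∀ {n} → ℕ → ℕ → List (Edge n) → Set
Sparse {n} k ℓ es = (S : Subset n) → spanned S es ≤ k * ∣ S ∣ ∸ ℓ

pebOn : ∀ {n} → (Fin n → ℕ) → Fin n → Fin n → ℕ
pebOn peb u v with u ≟ v
... | yes _ = peb u
... | no  _ = peb u + peb v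

adjust : ∀ {n} → (Fin n → ℕ) → Fin n → (ℕ → ℕ) → Fin n → ℕ
adjust f a g y with y ≟ a
... | yes _ = g (f y)
... | no  _ = f y

pathEdges : ∀ {n} → Fin n → List (Fin n) → List (Edge n)
pathEdges x []       = []
pathEdges x (y ∷ ys) = (x , y) ∷ pathEdges y ys

endOf : ∀ {n} → Fin n → List (Fin n) → Fin n
endOf x []       = x
endOf x (y ∷ ys) = endOf y ys

-- xs is (the tail of the vertex sequence of) a directed path x = x₀,x₁,…,x_m = w
-- in the directed multigraph D, whose edges are pathEdges x xs, and rest are
-- the remaining edges of D.
record DPath {n} (D : List (Edge n)) (x w : Fin n) : Set where
  constructor mkDPath
  field
    verts  : List (Fin n)
    ends   : endOf x verts ≡ w
    simple : Unique (x ∷ verts)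
    rest   : List (Edge n)
    split  : D ↭ (pathEdges x verts ++ rest)

reversed : ∀ {n} {D : List (Edge n)} {x w} → DPath D x w → List (Edge n)
reversed {x = x} p = map swap (pathEdges x (DPath.verts p)) ++ DPath.rest p

record CollectPath {n} (D : List (Edge n)) (peb : Fin n → ℕ) (u v : Fin n) : Set where
  constructor mkCollect
  field
    x    : Fin n
    xuv  : x ≡ u ⊎ x ≡ v
    w    : Fin n
    w≢u  : ¬ w ≡ u
    w≢v  : ¬ w ≡ v
    pebw : 1 ≤ peb w
    path : DPath D x w

record State (n : ℕ) : Set where
  constructor st
  field
    D    : List (Edge n)
    peb  : Fin n → ℕ
    todo : List (Edge n)       -- edges of G not yet processed; head = current edge

data Step {n} (k ℓ : ℕ) : State n → State n → Set where
  collect : ∀ {D peb u v es} (c : CollectPath D peb u v) →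
            pebOn peb u v < suc ℓ →
            Step k ℓ (st D peb ((u , v) ∷ es))
                     (st (reversed (CollectPath.path c))
                         (adjust (adjust peb (CollectPath.w c) pred) (CollectPath.x c) suc)
                         ((u , v) ∷ es))
  acceptU : ∀ {D peb u v es} → suc ℓ ≤ pebOn peb u v → 1 ≤ peb u →
            Step k ℓ (st D peb ((u , v) ∷ es)) (st ((u , v) ∷ D) (adjust peb u pred) es)
  acceptV : ∀ {D peb u v es} → suc ℓ ≤ pebOn peb u v → 1 ≤ peb v →
            Step k ℓ (st D peb ((u , v) ∷ es)) (st ((v , u) ∷ D) (adjust peb v pred) es)
  reject  : ∀ {D peb u v es} → pebOn peb u v < suc ℓ → ¬ CollectPath D peb u v →
            Step k ℓ (st D peb ((u , v) ∷ es)) (st D peb es)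

data Moment {n} (k ℓ : ℕ) (G : List (Edge n)) : State n → Set where
  start : ∀ {order} → order ↭ G → Moment k ℓ G (st [] (λ _ → k) order)
  step  : ∀ {s s'} → Moment k ℓ G s → Step k ℓ s s' → Moment k ℓ G s'

{-# OPTIONS --safe #-}

-- Throughout the game every vertex y has peb y + outdeg_D y = k: a pebble
-- collection move only shifts one pebble along the path it reverses, and an
-- accepted edge turns a free pebble of its tail into an out-edge.  Grow a set R
-- from {u, v} along edges of D leaving it, stopping as soon as a newly reached
-- vertex carries a free pebble (that vertex ends a collection path).  Otherwise R
-- ends up closed under out-edges with no free pebbles outside {u, v}; then the
-- edges of D spanned by R are exactly the out-edges of its vertices, and summing
-- the invariant over R gives k|R| = (pebbles on u, v) + spanned R D
-- ≤ ℓ + spanned R D, so adding uv to D violates (k,ℓ)-sparsity on R.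

module Submission where

open import Defs
open import Data.Bool using (true; false; if_then_else_)
open import Data.Empty using (⊥-elim)
open import Data.Fin using (Fin; zero; suc; _≟_)
open import Data.Fin.Subset using (Subset; ∣_∣; inside; outside; ⁅_⁆; _∪_; _⊆_; ⊥)
  renaming (_∈_ to _∈ₛ_; _∉_ to _∉ₛ_)
open import Data.Fin.Subset.Properties
  using (_∈?_; x∈⁅x⁆; x∈⁅y⁆⇒x≡y; x∈p∪q⁺; x∈p∪q⁻; p⊆p∪q; p⊂q⇒∣p∣<∣q∣; ∣p∣≤n; drop-there;
         ∪-idem; ∪-identityˡ; ∪-identityʳ)
open import Data.List using (List; []; _∷_; _++_; [_]; map)
open import Data.List.Membership.Propositional using (_∈_; _∉_; find; lose)
open import Data.List.Membership.Propositional.Properties using (∈-∃++; ∈-++⁻)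
open import Data.List.Properties using (map-++; ++-assoc)
open import Data.List.Relation.Binary.Permutation.Propositional using (_↭_; ↭-refl; module PermutationReasoning)
open import Data.List.Relation.Binary.Permutation.Propositional.Properties using (map⁺; ∈-resp-↭; ++⁺ˡ; shift)
open import Data.List.Relation.Unary.All as All using (All; []; _∷_)
import Data.List.Relation.Unary.All.Properties as All
open import Data.List.Relation.Unary.AllPairs using ([]; _∷_)
open import Data.List.Relation.Unary.Any using (here; there; any?)
import Data.List.Relation.Unary.Unique.Propositional.Properties as Unique
open import Data.Nat using (ℕ; zero; suc; _+_; _*_; _∸_; _≤_; _<_; pred; >-nonZero; s≤s; z≤n)
open import Data.Nat.ListAction using (sum)
open import Data.Nat.ListAction.Properties using (sum-++; sum-↭)
open import Data.Nat.Properties hiding (_≟_)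
open import Algebra.Properties.CommutativeSemigroup +-commutativeSemigroup using (x∙yz≈y∙xz; interchange)
open import Data.Nat.Tactic.RingSolver using (solve-∀)
open import Data.Product using (_×_; _,_; Σ; ∃-syntax; proj₁; proj₂)
open import Data.Sum using (_⊎_; inj₁; inj₂; [_,_]′)
import Data.Sum as Sum
open import Data.Vec using ([]; _∷_; lookup; here; there)
open import Data.Vec.Properties using ([]=⇒lookup; lookup⇒[]=)
open import Function using (_∘_)
open import Relation.Nullary using (¬_; yes; no; does; _×-dec_; ¬?; contradiction; decidable-stable)
open import Relation.Binary.PropositionalEquality
  using (_≡_; _≢_; refl; sym; trans; cong; cong₂; subst; module ≡-Reasoning)

δ : ∀ {n} → Fin n → Fin n → ℕ
δ y a = if does (y ≟ a) then 1 else 0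

outdeg : ∀ {n} → List (Edge n) → Fin n → ℕ
outdeg D y = sum (map (δ y ∘ proj₁) D)

outdeg-++ : ∀ {n} (D D′ : List (Edge n)) y → outdeg (D ++ D′) y ≡ outdeg D y + outdeg D′ y
outdeg-++ D D′ y = trans (cong sum (map-++ (δ y ∘ proj₁) D D′)) (sum-++ (map (δ y ∘ proj₁) D) _)

outdeg-↭ : ∀ {n} {D D′ : List (Edge n)} y → D ↭ D′ → outdeg D y ≡ outdeg D′ y
outdeg-↭ y D↭D′ = sum-↭ (map⁺ (δ y ∘ proj₁) D↭D′)

outdeg-pathEdges : ∀ {n} (x : Fin n) vs y →
                   δ y (endOf x vs) + outdeg (pathEdges x vs) y ≡ δ y x + outdeg (map swap (pathEdges x vs)) y
outdeg-pathEdges x []       y = refl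
outdeg-pathEdges x (z ∷ zs) y =
  trans (x∙yz≈y∙xz (δ y (endOf z zs)) (δ y x) _) (cong (δ y x +_) (outdeg-pathEdges z zs y))

adjust-suc : ∀ {n} (f : Fin n → ℕ) a y → adjust f a suc y ≡ δ y a + f y
adjust-suc f a y with y ≟ a
... | yes _ = refl
... | no  _ = refl

adjust-pred : ∀ {n} (f : Fin n → ℕ) {a} → 1 ≤ f a → ∀ y → adjust f a pred y + δ y a ≡ f y
adjust-pred f {a} 1≤fa y with y ≟ a
... | yes refl = trans (+-comm (pred (f y)) 1) (suc-pred (f y) {{>-nonZero 1≤fa}})
... | no  _    = +-identityʳ (f y)

+-exchange : ∀ a b {c d p o : ℕ} → a + d ≡ c + p → c + b ≡ d + o → a + b ≡ p + o
+-exchange a b {c} {d} {p} {o} ad≡cp cb≡do = +-cancelʳ-≡ (c + d) (a + b) (p + o) (begin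
  a + b + (c + d)     ≡⟨ regroupˡ a b c d ⟩
  (a + d) + (c + b)   ≡⟨ cong₂ _+_ ad≡cp cb≡do ⟩
  (c + p) + (d + o)   ≡⟨ regroupʳ c p d o ⟩
  p + o + (c + d)     ∎)
  where
    open ≡-Reasoning
    regroupˡ : ∀ a b c d → a + b + (c + d) ≡ (a + d) + (c + b)
    regroupˡ = solve-∀
    regroupʳ : ∀ c p d o → (c + p) + (d + o) ≡ p + o + (c + d)
    regroupʳ = solve-∀

-- Each of the k pebbles of y is either free or placed on an edge of D leaving y.
Balanced : ∀ {n} → ℕ → List (Edge n) → (Fin n → ℕ) → Set
Balanced k D peb = ∀ y → peb y + outdeg D y ≡ k

insertion-balanced : ∀ {n k} {D : List (Edge n)} {peb a} b → 1 ≤ peb a →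
                     Balanced k D peb → Balanced k ((a , b) ∷ D) (adjust peb a pred)
insertion-balanced {k = k} {D} {peb} {a} b 1≤peb-a balanced y = begin
  adjust peb a pred y + (δ y a + outdeg D y)  ≡⟨ +-assoc (adjust peb a pred y) _ _ ⟨
  adjust peb a pred y + δ y a + outdeg D y    ≡⟨ cong (_+ outdeg D y) (adjust-pred peb 1≤peb-a y) ⟩
  peb y + outdeg D y                          ≡⟨ balanced y ⟩
  k                                           ∎
  where open ≡-Reasoning

-- The move takes a pebble from w and gives one to x, while reversing the path
-- adds one to the out-degree of x and removes one from that of w.
reversal-balanced : ∀ {n k} {D : List (Edge n)} {peb x w} (p : DPath D x w) → 1 ≤ peb w →
                    Balanced k D peb → Balanced k (reversed p) (adjust (adjust peb w pred) x suc)
reversal-balanced {D = D} {peb} {x} (mkDPath vs refl _ rest split) 1≤peb-w balanced y =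
  trans (+-exchange _ (outdeg (map swap P ++ rest) y) pebbles edges) (balanced y)
  where
    open ≡-Reasoning
    w = endOf x vs
    P = pathEdges x vs
    pebbles : adjust (adjust peb w pred) x suc y + δ y w ≡ δ y x + peb y
    pebbles = begin
      adjust (adjust peb w pred) x suc y + δ y w  ≡⟨ cong (_+ δ y w) (adjust-suc _ x y) ⟩
      δ y x + adjust peb w pred y + δ y w         ≡⟨ +-assoc (δ y x) _ _ ⟩
      δ y x + (adjust peb w pred y + δ y w)       ≡⟨ cong (δ y x +_) (adjust-pred peb 1≤peb-w y) ⟩
      δ y x + peb y                               ∎
    edges : δ y x + outdeg (map swap P ++ rest) y ≡ δ y w + outdeg D y
    edges = begin
      δ y x + outdeg (map swap P ++ rest) y          ≡⟨ cong (δ y x +_) (outdeg-++ (map swap P) rest y) ⟩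
      δ y x + (outdeg (map swap P) y + outdeg rest y) ≡⟨ +-assoc (δ y x) _ _ ⟨
      δ y x + outdeg (map swap P) y + outdeg rest y   ≡⟨ cong (_+ outdeg rest y) (outdeg-pathEdges x vs y) ⟨
      δ y w + outdeg P y + outdeg rest y              ≡⟨ +-assoc (δ y w) _ _ ⟩
      δ y w + (outdeg P y + outdeg rest y)            ≡⟨ cong (δ y w +_) (outdeg-++ P rest y) ⟨
      δ y w + outdeg (P ++ rest) y                    ≡⟨ cong (δ y w +_) (outdeg-↭ y split) ⟨
      δ y w + outdeg D y                              ∎

step-balanced : ∀ {n k ℓ} {s s′ : State n} → Step k ℓ s s′ →
                Balanced k (State.D s) (State.peb s) → Balanced k (State.D s′) (State.peb s′)
step-balanced (collect c _)                        = reversal-balanced (CollectPath.path c)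
                                                                       (CollectPath.pebw c)
step-balanced (acceptU {D = D} {v = v} _ 1≤peb-u) = insertion-balanced {D = D} v 1≤peb-u
step-balanced (acceptV {D = D} {u = u} _ 1≤peb-v) = insertion-balanced {D = D} u 1≤peb-v
step-balanced (reject _ _)                         = λ balanced → balanced

moment-balanced : ∀ {n k ℓ} {G : List (Edge n)} {s} → Moment k ℓ G s → Balanced k (State.D s) (State.peb s)
moment-balanced (start _)       y = +-identityʳ _
moment-balanced (step m s→s′) = step-balanced s→s′ (moment-balanced m)

sumOver : ∀ {n} → Subset n → (Fin n → ℕ) → ℕ
sumOver []            f = 0
sumOver (inside  ∷ R) f = f zero + sumOver R (f ∘ suc)
sumOver (outside ∷ R) f = sumOver R (f ∘ suc)

sumOver-zero : ∀ {n} (R : Subset n) → sumOver R (λ _ → 0) ≡ 0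
sumOver-zero []            = refl
sumOver-zero (inside  ∷ R) = sumOver-zero R
sumOver-zero (outside ∷ R) = sumOver-zero R

sumOver-⊥ : ∀ {n} f → sumOver {n} ⊥ f ≡ 0
sumOver-⊥ {zero}  f = refl
sumOver-⊥ {suc n} f = sumOver-⊥ (f ∘ suc)

sumOver-const : ∀ {n} (R : Subset n) k → sumOver R (λ _ → k) ≡ k * ∣ R ∣
sumOver-const []            k = sym (*-zeroʳ k)
sumOver-const (inside  ∷ R) k = trans (cong (k +_) (sumOver-const R k)) (sym (*-suc k ∣ R ∣))
sumOver-const (outside ∷ R) k = sumOver-const R k

sumOver-cong : ∀ {n} (R : Subset n) {f g} → (∀ y → f y ≡ g y) → sumOver R f ≡ sumOver R g
sumOver-cong []            f≗g = refl
sumOver-cong (inside  ∷ R) f≗g = cong₂ _+_ (f≗g zero) (sumOver-cong R (f≗g ∘ suc))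
sumOver-cong (outside ∷ R) f≗g = sumOver-cong R (f≗g ∘ suc)

sumOver-+ : ∀ {n} (R : Subset n) f g → sumOver R (λ y → f y + g y) ≡ sumOver R f + sumOver R g
sumOver-+ []            f g = refl
sumOver-+ (inside  ∷ R) f g =
  trans (cong (f zero + g zero +_) (sumOver-+ R (f ∘ suc) (g ∘ suc)))
        (interchange (f zero) (g zero) _ _)
sumOver-+ (outside ∷ R) f g = sumOver-+ R (f ∘ suc) (g ∘ suc)

sumOver-δ : ∀ {n} (R : Subset n) a → sumOver R (λ y → δ y a) ≡ (if lookup R a then 1 else 0)
sumOver-δ (inside  ∷ R) zero    = cong suc (sumOver-zero R)
sumOver-δ (outside ∷ R) zero    = sumOver-zero R
sumOver-δ (inside  ∷ R) (suc a) = sumOver-δ R a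
sumOver-δ (outside ∷ R) (suc a) = sumOver-δ R a

sumOver-⁅⁆ : ∀ {n} (a : Fin n) f → sumOver ⁅ a ⁆ f ≡ f a
sumOver-⁅⁆ zero    f = trans (cong (f zero +_) (sumOver-⊥ (f ∘ suc))) (+-identityʳ (f zero))
sumOver-⁅⁆ (suc a) f = sumOver-⁅⁆ a (f ∘ suc)

sumOver-⁅⁆∪⁅⁆ : ∀ {n} {a b : Fin n} f → a ≢ b → sumOver (⁅ a ⁆ ∪ ⁅ b ⁆) f ≡ f a + f b
sumOver-⁅⁆∪⁅⁆ {a = zero}  {zero}  f a≢b = contradiction refl a≢b
sumOver-⁅⁆∪⁅⁆ {a = zero}  {suc b} f _ rewrite ∪-identityˡ ⁅ b ⁆ =
  cong (f zero +_) (sumOver-⁅⁆ b (f ∘ suc))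
sumOver-⁅⁆∪⁅⁆ {a = suc a} {zero}  f _ rewrite ∪-identityʳ ⁅ a ⁆ =
  trans (cong (f zero +_) (sumOver-⁅⁆ a (f ∘ suc))) (+-comm (f zero) (f (suc a)))
sumOver-⁅⁆∪⁅⁆ {a = suc a} {suc b} f a≢b = sumOver-⁅⁆∪⁅⁆ (f ∘ suc) (a≢b ∘ cong suc)

sumOver-⁅⁆∪⁅⁆≡pebOn : ∀ {n} f (a b : Fin n) → sumOver (⁅ a ⁆ ∪ ⁅ b ⁆) f ≡ pebOn f a b
sumOver-⁅⁆∪⁅⁆≡pebOn f a b with a ≟ b
... | yes refl = trans (cong (λ R → sumOver R f) (∪-idem ⁅ a ⁆)) (sumOver-⁅⁆ a f)
... | no  a≢b  = sumOver-⁅⁆∪⁅⁆ f a≢b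

sumOver-mono-support : ∀ {n} (R S : Subset n) {f} → (∀ {y} → y ∈ₛ R → y ∉ₛ S → f y ≡ 0) →
                       sumOver R f ≤ sumOver S f
sumOver-mono-support []            []            f₀ = ≤-refl
sumOver-mono-support (inside  ∷ R) (inside  ∷ S) {f} f₀ =
  +-monoʳ-≤ (f zero) (sumOver-mono-support R S (λ y∈R y∉S → f₀ (there y∈R) (y∉S ∘ drop-there)))
sumOver-mono-support (inside  ∷ R) (outside ∷ S) f₀ rewrite f₀ here (λ ()) =
  sumOver-mono-support R S (λ y∈R y∉S → f₀ (there y∈R) (y∉S ∘ drop-there))
sumOver-mono-support (outside ∷ R) (inside  ∷ S) {f} f₀ =
  ≤-trans (sumOver-mono-support R S (λ y∈R y∉S → f₀ (there y∈R) (y∉S ∘ drop-there))) (m≤n+m _ (f zero))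
sumOver-mono-support (outside ∷ R) (outside ∷ S) f₀ =
  sumOver-mono-support R S (λ y∈R y∉S → f₀ (there y∈R) (y∉S ∘ drop-there))

Closed : ∀ {n} → List (Edge n) → Subset n → Set
Closed D R = ∀ {a b} → (a , b) ∈ D → a ∈ₛ R → b ∈ₛ R

spanned-∷ : ∀ {n} (R : Subset n) {a b} D → (lookup R a ≡ true → lookup R b ≡ true) →
            spanned R ((a , b) ∷ D) ≡ (if lookup R a then 1 else 0) + spanned R D
spanned-∷ R {a} D a∈R⇒b∈R with lookup R a
... | false = refl
... | true rewrite a∈R⇒b∈R refl = refl

spanned-closed : ∀ {n} (R : Subset n) D → Closed D R → spanned R D ≡ sumOver R (outdeg D)
spanned-closed R []            closed = sym (sumOver-zero R)
spanned-closed R ((a , b) ∷ D) closed = begin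
  spanned R ((a , b) ∷ D)
    ≡⟨ spanned-∷ R D ([]=⇒lookup ∘ closed (here refl) ∘ lookup⇒[]= a R) ⟩
  (if lookup R a then 1 else 0) + spanned R D
    ≡⟨ cong₂ _+_ (sumOver-δ R a) (sym (spanned-closed R D (closed ∘ there))) ⟨
  sumOver R (λ y → δ y a) + sumOver R (outdeg D)
    ≡⟨ sumOver-+ R (λ y → δ y a) (outdeg D) ⟨
  sumOver R (outdeg ((a , b) ∷ D))
    ∎
  where open ≡-Reasoning

pebbles+spanned : ∀ {n k} {D : List (Edge n)} {peb} (R : Subset n) → Balanced k D peb → Closed D R →
                  k * ∣ R ∣ ≡ sumOver R peb + spanned R D
pebbles+spanned {k = k} {D} {peb} R balanced closed = begin
  k * ∣ R ∣                               ≡⟨ sumOver-const R k ⟨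
  sumOver R (λ _ → k)                     ≡⟨ sumOver-cong R (sym ∘ balanced) ⟩
  sumOver R (λ y → peb y + outdeg D y)    ≡⟨ sumOver-+ R peb (outdeg D) ⟩
  sumOver R peb + sumOver R (outdeg D)    ≡⟨ cong (sumOver R peb +_) (spanned-closed R D closed) ⟨
  sumOver R peb + spanned R D             ∎
  where open ≡-Reasoning

endOf-∷ʳ : ∀ {n} (x : Fin n) vs b → endOf x (vs ++ [ b ]) ≡ b
endOf-∷ʳ x []       b = refl
endOf-∷ʳ x (z ∷ zs) b = endOf-∷ʳ z zs b

pathEdges-∷ʳ : ∀ {n} (x : Fin n) vs b → pathEdges x (vs ++ [ b ]) ≡ pathEdges x vs ++ [ (endOf x vs , b) ]
pathEdges-∷ʳ x []       b = refl
pathEdges-∷ʳ x (z ∷ zs) b = cong ((x , z) ∷_) (pathEdges-∷ʳ z zs b)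

∈-pathEdges⇒∈ : ∀ {n} (x : Fin n) vs {a b} → (a , b) ∈ pathEdges x vs → b ∈ vs
∈-pathEdges⇒∈ x (z ∷ zs) (here refl) = here refl
∈-pathEdges⇒∈ x (z ∷ zs) (there e∈) = there (∈-pathEdges⇒∈ z zs e∈)

∈⇒↭∷ : ∀ {A : Set} {e : A} {L} → e ∈ L → ∃[ L′ ] L ↭ e ∷ L′
∈⇒↭∷ e∈L with ys , zs , refl ← ∈-∃++ e∈L = ys ++ zs , shift _ ys zs

DPath-[] : ∀ {n} {D : List (Edge n)} {x} → DPath D x x
DPath-[] {D = D} = mkDPath [] refl ([] ∷ []) D ↭-refl

DPath-∷ʳ : ∀ {n} {D : List (Edge n)} {x a b} (p : DPath D x a) → (a , b) ∈ D →
           b ∉ x ∷ DPath.verts p → DPath D x b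
DPath-∷ʳ {D = D} {x} {b = b} (mkDPath vs ends simple rest split) ab∈D b∉p =
  mkDPath (vs ++ [ b ]) (endOf-∷ʳ x vs b) (Unique.++⁺ simple ([] ∷ []) disjoint) rest′ split′
  where
    open PermutationReasoning
    e = (endOf x vs , b)
    disjoint : ∀ {c} → ¬ (c ∈ x ∷ vs × c ∈ [ b ])
    disjoint (b∈p , here refl) = b∉p b∈p
    e∈rest : e ∈ rest
    e∈rest with ∈-++⁻ (pathEdges x vs) (∈-resp-↭ split (subst (λ a → (a , b) ∈ D) (sym ends) ab∈D))
    ... | inj₁ e∈P    = contradiction (there (∈-pathEdges⇒∈ x vs e∈P)) b∉p
    ... | inj₂ e∈rest = e∈rest
    rest′ = proj₁ (∈⇒↭∷ e∈rest)
    split′ : D ↭ pathEdges x (vs ++ [ b ]) ++ rest′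
    split′ = begin
      D                                   ↭⟨ split ⟩
      pathEdges x vs ++ rest              ↭⟨ ++⁺ˡ (pathEdges x vs) (proj₂ (∈⇒↭∷ e∈rest)) ⟩
      pathEdges x vs ++ e ∷ rest′          ≡⟨ ++-assoc (pathEdges x vs) [ e ] rest′ ⟨
      (pathEdges x vs ++ [ e ]) ++ rest′   ≡⟨ cong (_++ rest′) (pathEdges-∷ʳ x vs b) ⟨
      pathEdges x (vs ++ [ b ]) ++ rest′   ∎

Leaves : ∀ {n} → Subset n → Edge n → Set
Leaves R e = proj₁ e ∈ₛ R × proj₂ e ∉ₛ R

closed-or-leaving : ∀ {n} (D : List (Edge n)) R → Closed D R ⊎ ∃[ e ] e ∈ D × Leaves R e
closed-or-leaving D R with any? (λ e → proj₁ e ∈? R ×-dec ¬? (proj₂ e ∈? R)) D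
... | yes leaving = inj₂ (find leaving)
... | no ¬leaving = inj₁ λ {a} {b} ab∈D a∈R →
  decidable-stable (b ∈? R) (λ b∉R → ¬leaving (lose ab∈D (a∈R , b∉R)))

∣p∣<∣p∪⁅x⁆∣ : ∀ {n} {x : Fin n} {p} → x ∉ₛ p → ∣ p ∣ < ∣ p ∪ ⁅ x ⁆ ∣
∣p∣<∣p∪⁅x⁆∣ {x = x} x∉p = p⊂q⇒∣p∣<∣q∣ (p⊆p∪q ⁅ x ⁆ , x , x∈p∪q⁺ (inj₂ (x∈⁅x⁆ x)) , x∉p)

module Exploration {n} (D : List (Edge n)) (peb : Fin n → ℕ) (u v : Fin n) where

  ReachableWithin : Subset n → Fin n → Set
  ReachableWithin R y = ∃[ x ] (x ≡ u ⊎ x ≡ v) × Σ (DPath D x y) λ p → All (_∈ₛ R) (x ∷ DPath.verts p)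

  record Explored (R : Subset n) : Set where
    field
      u∈R        : u ∈ₛ R
      v∈R        : v ∈ₛ R
      pebbleless : ∀ {y} → y ∈ₛ R → y ≢ u → y ≢ v → peb y ≡ 0
      reachable  : ∀ {y} → y ∈ₛ R → ReachableWithin R y
  open Explored

  ⁅u⁆∪⁅v⁆-explored : Explored (⁅ u ⁆ ∪ ⁅ v ⁆)
  ⁅u⁆∪⁅v⁆-explored = record
    { u∈R        = x∈p∪q⁺ (inj₁ (x∈⁅x⁆ u))
    ; v∈R        = x∈p∪q⁺ (inj₂ (x∈⁅x⁆ v))
    ; pebbleless = λ y∈ y≢u y≢v → ⊥-elim ([ y≢u , y≢v ]′ (∈⁅u⁆∪⁅v⁆⁻ y∈))
    ; reachable  = λ {y} y∈ → y , ∈⁅u⁆∪⁅v⁆⁻ y∈ , DPath-[] , y∈ ∷ []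
    }
    where
      ∈⁅u⁆∪⁅v⁆⁻ : ∀ {y} → y ∈ₛ ⁅ u ⁆ ∪ ⁅ v ⁆ → y ≡ u ⊎ y ≡ v
      ∈⁅u⁆∪⁅v⁆⁻ = Sum.map (x∈⁅y⁆⇒x≡y u) (x∈⁅y⁆⇒x≡y v) ∘ x∈p∪q⁻ ⁅ u ⁆ ⁅ v ⁆

  reachableWithin-mono : ∀ {R R′ y} → R ⊆ R′ → ReachableWithin R y → ReachableWithin R′ y
  reachableWithin-mono R⊆R′ (x , x∈uv , p , p⊆R) = x , x∈uv , p , All.map R⊆R′ p⊆R

  reach-across : ∀ {R a b} → Explored R → (a , b) ∈ D → a ∈ₛ R → b ∉ₛ R →
                 ReachableWithin (R ∪ ⁅ b ⁆) b
  reach-across {b = b} ex ab∈D a∈R b∉R with reachable ex a∈R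
  ... | x , x∈uv , p , p⊆R =
    x , x∈uv , DPath-∷ʳ p ab∈D (b∉R ∘ All.lookup p⊆R) ,
    All.++⁺ (All.map (p⊆p∪q ⁅ b ⁆) p⊆R) (x∈p∪q⁺ (inj₂ (x∈⁅x⁆ b)) ∷ [])

  explored-∪⁅⁆ : ∀ {R a b} → Explored R → (a , b) ∈ D → a ∈ₛ R → b ∉ₛ R → peb b ≡ 0 →
                 Explored (R ∪ ⁅ b ⁆)
  explored-∪⁅⁆ {R} {b = b} ex ab∈D a∈R b∉R peb-b≡0 = record
    { u∈R        = p⊆p∪q ⁅ b ⁆ (u∈R ex)
    ; v∈R        = p⊆p∪q ⁅ b ⁆ (v∈R ex)
    ; pebbleless = λ y∈ y≢u y≢v → [ (λ y∈R → pebbleless ex y∈R y≢u y≢v)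
                                  , (λ y∈⁅b⁆ → trans (cong peb (x∈⁅y⁆⇒x≡y b y∈⁅b⁆)) peb-b≡0)
                                  ]′ (x∈p∪q⁻ R ⁅ b ⁆ y∈)
    ; reachable  = λ y∈ → [ reachableWithin-mono (p⊆p∪q ⁅ b ⁆) ∘ reachable ex
                          , (λ y∈⁅b⁆ → subst (ReachableWithin (R ∪ ⁅ b ⁆)) (sym (x∈⁅y⁆⇒x≡y b y∈⁅b⁆))
                                              (reach-across ex ab∈D a∈R b∉R))
                          ]′ (x∈p∪q⁻ R ⁅ b ⁆ y∈)
    }

  explore-edge : ∀ {R a b} → Explored R → (a , b) ∈ D → a ∈ₛ R → b ∉ₛ R →
                 CollectPath D peb u v ⊎ Explored (R ∪ ⁅ b ⁆)
  explore-edge {b = b} ex ab∈D a∈R b∉R with peb b in peb-b | reach-across ex ab∈D a∈R b∉R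
  ... | zero  | _               = inj₂ (explored-∪⁅⁆ ex ab∈D a∈R b∉R peb-b)
  ... | suc _ | x , x∈uv , q , _ =
    inj₁ (mkCollect x x∈uv b (λ { refl → b∉R (u∈R ex) }) (λ { refl → b∉R (v∈R ex) })
                    (subst (1 ≤_) (sym peb-b) (s≤s z≤n)) q)

  search : ∀ fuel R → n ≤ fuel + ∣ R ∣ → Explored R →
           CollectPath D peb u v ⊎ ∃[ R ] Explored R × Closed D R
  search fuel R n≤ ex with closed-or-leaving D R
  ... | inj₁ closed = inj₂ (R , ex , closed)
  ... | inj₂ ((a , b) , ab∈D , a∈R , b∉R) with explore-edge ex ab∈D a∈R b∉R | fuel
  ...   | inj₁ c   | _         = inj₁ c
  ...   | inj₂ _   | zero      =
    contradiction (<-≤-trans (∣p∣<∣p∪⁅x⁆∣ b∉R) (∣p∣≤n (R ∪ ⁅ b ⁆))) (≤⇒≯ n≤)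
  ...   | inj₂ ex′ | suc fuel′ = search fuel′ (R ∪ ⁅ b ⁆) n≤′ ex′
    where
      n≤′ : n ≤ fuel′ + ∣ R ∪ ⁅ b ⁆ ∣
      n≤′ = ≤-trans n≤ (≤-trans (≤-reflexive (sym (+-suc fuel′ ∣ R ∣)))
                                (+-monoʳ-≤ fuel′ (∣p∣<∣p∪⁅x⁆∣ b∉R)))

  sumOver-peb≤pebOn : ∀ {R} → Explored R → sumOver R peb ≤ pebOn peb u v
  sumOver-peb≤pebOn {R} ex =
    ≤-trans (sumOver-mono-support R (⁅ u ⁆ ∪ ⁅ v ⁆) vanish) (≤-reflexive (sumOver-⁅⁆∪⁅⁆≡pebOn peb u v))
    where
      vanish : ∀ {y} → y ∈ₛ R → y ∉ₛ ⁅ u ⁆ ∪ ⁅ v ⁆ → peb y ≡ 0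
      vanish y∈R y∉uv = pebbleless ex y∈R (λ { refl → y∉uv (x∈p∪q⁺ (inj₁ (x∈⁅x⁆ u))) })
                                          (λ { refl → y∉uv (x∈p∪q⁺ (inj₂ (x∈⁅x⁆ v))) })

  closed-explored-not-sparse : ∀ {k ℓ R} → Balanced k D peb → Explored R → Closed D R →
                               pebOn peb u v < suc ℓ → ¬ Sparse k ℓ ((u , v) ∷ D)
  closed-explored-not-sparse {k} {ℓ} {R} balanced ex closed few sparse = <-irrefl refl (begin-strict
    spanned R D                          <⟨ n<1+n (spanned R D) ⟩
    suc (spanned R D)                    ≡⟨ spanned-uv ⟨
    spanned R ((u , v) ∷ D)              ≤⟨ sparse R ⟩
    k * ∣ R ∣ ∸ ℓ                        ≡⟨ cong (_∸ ℓ) (pebbles+spanned R balanced closed) ⟩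
    sumOver R peb + spanned R D ∸ ℓ      ≤⟨ ∸-monoˡ-≤ ℓ (+-monoˡ-≤ (spanned R D) pebbles≤ℓ) ⟩
    ℓ + spanned R D ∸ ℓ                  ≡⟨ m+n∸m≡n ℓ (spanned R D) ⟩
    spanned R D                          ∎)
    where
      open ≤-Reasoning
      pebbles≤ℓ : sumOver R peb ≤ ℓ
      pebbles≤ℓ = ≤-trans (sumOver-peb≤pebOn ex) (≤-pred few)
      spanned-uv : spanned R ((u , v) ∷ D) ≡ suc (spanned R D)
      spanned-uv rewrite spanned-∷ R {u} {v} D (λ _ → []=⇒lookup (v∈R ex)) | []=⇒lookup (u∈R ex) = refl

  collectPath : ∀ {k ℓ} → Balanced k D peb → Sparse k ℓ ((u , v) ∷ D) → pebOn peb u v < suc ℓ →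
                CollectPath D peb u v
  collectPath balanced sparse few with search n (⁅ u ⁆ ∪ ⁅ v ⁆) (m≤m+n n _) ⁅u⁆∪⁅v⁆-explored
  ... | inj₁ c                 = c
  ... | inj₂ (R , ex , closed) = contradiction sparse (closed-explored-not-sparse balanced ex closed few)

lemma13 : (k ℓ n : ℕ) → 1 ≤ k → ℓ < 2 * k →
          (ℓ ≤ k → 1 ≤ n) → (k < ℓ → 2 ≤ n) →
          (G : List (Edge n)) (s : State n) → Moment k ℓ G s →
          (u v : Fin n) → (u , v) ∈ State.todo s →
          Sparse k ℓ ((u , v) ∷ State.D s) →
          pebOn (State.peb s) u v < suc ℓ →
          CollectPath (State.D s) (State.peb s) u v
lemma13 k ℓ n _ _ _ _ G s moment u v _ sparse few =
  Exploration.collectPath (State.D s) (State.peb s) u v (moment-balanced moment) sparse few
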